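{- Let $G=(V,E)$ be a finite simple undirected graph, let $k\ge 0$ be an integer, and let $u,v\in V$ be vertices such that $N(v)\subset N(u)$ or $N[v]\subset N[u]$. If there exists a set $S\in\mathcal{S}(G,k)$ with $v\in S$ and $u\notin S$, then $(S\setminus\{v\})\cup\{u\}\in\mathcal{S}(G,k)$.
   Context: $N(x)=\{w:\{x,w\}\in E\}$ is the open neighborhood and $N[x]=N(x)\cup\{x\}$ the closed neighborhood; $\subset$ denotes proper inclusion. For $S\subseteq V$, $G[S]$ is the induced subgraph; $\omega(H)$ is the size of a largest clique in $H$; $\theta(G,k)=\min_{S\subseteq V,\ |S|\le k}\omega(G[V\setminus S])$; and $\mathcal{S}(G,k)=\{S\subseteq V : |S|\le k,\ \omega(G[V\setminus S])=\theta(G,k)\}$ is the set of optimal interdiction sets. -}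

module Defs where

open import Data.Nat using (ℕ; _≤_)
open import Data.Bool using (Bool; true; false)
open import Data.Fin using (Fin)
open import Data.Fin.Subset using (Subset; _∈_; _∉_; _∪_; _-_; ⁅_⁆; ∣_∣; _⊆_)
open import Data.Vec using (tabulate)
open import Data.Product using (Σ; ∃; _×_)
open import Relation.Binary.PropositionalEquality using (_≡_; _≢_)

record Graph (n : ℕ) : Set where
  field
    adj     : Fin n → Fin n → Bool
    sym     : ∀ x y → adj x y ≡ adj y x
    irrefl  : ∀ x → adj x x ≡ false

open Graph public

Adj : ∀ {n} → Graph n → Fin n → Fin n → Set
Adj G x y = adj G x y ≡ true

N : ∀ {n} → Graph n → Fin n → Subset n
N G x = tabulate (λ w → adj G x w)

N[_,_] : ∀ {n} → Graph n → Fin n → Subset n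
N[ G , x ] = N G x ∪ ⁅ x ⁆

IsCliqueAvoiding : ∀ {n} → Graph n → Subset n → Subset n → Set
IsCliqueAvoiding G S C =
  (∀ {x} → x ∈ C → x ∉ S) ×
  (∀ {x y} → x ∈ C → y ∈ C → x ≢ y → Adj G x y)

CliqueNumberAvoiding : ∀ {n} → Graph n → Subset n → ℕ → Set
CliqueNumberAvoiding G S m =
  (Σ (Subset _) λ C → IsCliqueAvoiding G S C × ∣ C ∣ ≡ m) ×
  (∀ C → IsCliqueAvoiding G S C → ∣ C ∣ ≤ m)

Theta : ∀ {n} → Graph n → ℕ → ℕ → Set
Theta G k t =
  (Σ (Subset _) λ S → ∣ S ∣ ≤ k × CliqueNumberAvoiding G S t) ×
  (∀ S m → ∣ S ∣ ≤ k → CliqueNumberAvoiding G S m → t ≤ m)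

OptInterdiction : ∀ {n} → Graph n → ℕ → Subset n → Set
OptInterdiction G k S =
  ∣ S ∣ ≤ k × ∃ λ t → Theta G k t × CliqueNumberAvoiding G S t

{-# OPTIONS --safe #-}
-- Only the inclusion N(v) ⊆ N(u) (or N[v] ⊆ N[u]) matters: it says every neighbour of v
-- other than u is a neighbour of u. Moving the deletion from v to u keeps the budget, and a
-- clique of G − S' that uses v can trade v for u (which S' now deletes, so it is not in the
-- clique), giving a clique of G − S of the same size. Hence ω(G − S') ≤ ω(G − S) = θ(G,k),
-- and the reverse inequality is the minimality of θ.
module Submission where

open import Defs hiding (sym)
open import Data.Nat using (ℕ; zero; suc; _≤_)
open import Data.Nat.Properties using (_≟_; ≤-antisym; ≤∧≢⇒<; m<1+n⇒m≤n)
open import Data.Bool using (true)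
import Data.Bool.Properties as Bool
open import Data.Fin using (Fin; zero; suc)
import Data.Fin.Properties as Fin
open import Data.Fin.Subset
  using (Subset; _∈_; _∉_; _∪_; _─_; _-_; ⁅_⁆; _⊂_; _⊆_; ⊥; ∣_∣; inside; outside)
open import Data.Fin.Subset.Properties
open import Data.Vec using (_∷_; here; there)
open import Data.Vec.Properties using (lookup∘tabulate; lookup⇒[]=; []=⇒lookup)
open import Data.Product using (Σ; ∃; _×_; _,_; proj₁; proj₂)
open import Data.Sum using (_⊎_; inj₁; inj₂; [_,_]′)
open import Function using (_∘_)
open import Relation.Nullary using (Dec; yes; no; ¬?; contradiction)
open import Relation.Nullary.Decidable using (_×-dec_; _→-dec_; map′)
open import Relation.Unary using (Decidable)
open import Relation.Binary.PropositionalEquality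
  using (_≡_; _≢_; refl; sym; trans; cong; subst)

private
  variable
    n : ℕ
    x y z : Fin n
    p : Subset n

module _ (G : Graph n) where

  Adj-sym : Adj G x y → Adj G y x
  Adj-sym {x = x} {y} xy = trans (Graph.sym G y x) xy

  Adj⇒∈N : Adj G x y → y ∈ N G x
  Adj⇒∈N {y = y} xy = lookup⇒[]= y _ (trans (lookup∘tabulate _ y) xy)

  ∈N⇒Adj : y ∈ N G x → Adj G x y
  ∈N⇒Adj {y = y} y∈Nx = trans (sym (lookup∘tabulate _ y)) ([]=⇒lookup y∈Nx)

  Dominates : Fin n → Fin n → Set
  Dominates u v = ∀ {x} → Adj G v x → x ≢ u → Adj G u x

  N⊆N⇒dominates : ∀ {u v} → N G v ⊆ N G u → Dominates u v
  N⊆N⇒dominates Nv⊆Nu vx _ = ∈N⇒Adj (Nv⊆Nu (Adj⇒∈N vx))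

  N[]⊆N[]⇒dominates : ∀ {u v} → N[ G , v ] ⊆ N[ G , u ] → Dominates u v
  N[]⊆N[]⇒dominates {u} Nv⊆Nu vx x≢u with x∈p∪q⁻ _ _ (Nv⊆Nu (x∈p∪q⁺ (inj₁ (Adj⇒∈N vx))))
  ... | inj₁ x∈Nu  = ∈N⇒Adj x∈Nu
  ... | inj₂ x∈⁅u⁆ = contradiction (x∈⁅y⁆⇒x≡y u x∈⁅u⁆) x≢u

x∈p─q⇒x∉q : ∀ (p q : Subset n) → x ∈ p ─ q → x ∉ q
x∈p─q⇒x∉q (_ ∷ p) (inside  ∷ q) (there x∈p─q) (there x∈q) = x∈p─q⇒x∉q p q x∈p─q x∈q
x∈p─q⇒x∉q (_ ∷ p) (outside ∷ q) (there x∈p─q) (there x∈q) = x∈p─q⇒x∉q p q x∈p─q x∈q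
x∈p─q⇒x∉q (inside ∷ p) (outside ∷ q) here ()

x∈p-y⇒x≢y : x ∈ p - y → x ≢ y
x∈p-y⇒x≢y {p = p} {y} x∈p-y refl = x∈p─q⇒x∉q p ⁅ y ⁆ x∈p-y (x∈⁅x⁆ y)

∣p∣≡1+∣p-x∣ : x ∈ p → ∣ p ∣ ≡ suc ∣ p - x ∣
∣p∣≡1+∣p-x∣ {x = zero}  {inside ∷ p}  here        = cong (suc ∘ ∣_∣) (sym (p─⊥≡p p))
∣p∣≡1+∣p-x∣ {x = suc x} {inside ∷ p}  (there x∈p) = cong suc (∣p∣≡1+∣p-x∣ x∈p)
∣p∣≡1+∣p-x∣ {x = suc x} {outside ∷ p} (there x∈p) = ∣p∣≡1+∣p-x∣ x∈p

∣p∪⁅x⁆∣≡1+∣p∣ : x ∉ p → ∣ p ∪ ⁅ x ⁆ ∣ ≡ suc ∣ p ∣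
∣p∪⁅x⁆∣≡1+∣p∣ {x = zero}  {outside ∷ p} _   = cong (suc ∘ ∣_∣) (∪-identityʳ p)
∣p∪⁅x⁆∣≡1+∣p∣ {x = zero}  {inside ∷ p}  x∉p = contradiction here x∉p
∣p∪⁅x⁆∣≡1+∣p∣ {x = suc x} {inside ∷ p}  x∉p = cong suc (∣p∪⁅x⁆∣≡1+∣p∣ (x∉p ∘ there))
∣p∪⁅x⁆∣≡1+∣p∣ {x = suc x} {outside ∷ p} x∉p = ∣p∪⁅x⁆∣≡1+∣p∣ (x∉p ∘ there)

replace : Subset n → Fin n → Fin n → Subset n
replace p x y = (p - x) ∪ ⁅ y ⁆

∣replace∣ : x ∈ p → y ∉ p → ∣ replace p x y ∣ ≡ ∣ p ∣
∣replace∣ {p = p} x∈p y∉p = trans (∣p∪⁅x⁆∣≡1+∣p∣ (y∉p ∘ p─q⊆p p _)) (sym (∣p∣≡1+∣p-x∣ x∈p))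

∈-replaceˡ : z ∈ p → z ≢ x → z ∈ replace p x y
∈-replaceˡ z∈p z≢x = x∈p∪q⁺ (inj₁ (x∈p∧x≢y⇒x∈p-y z∈p z≢x))

∈-replaceʳ : y ∈ replace p x y
∈-replaceʳ {y = y} = x∈p∪q⁺ (inj₂ (x∈⁅x⁆ y))

∈-replace⁻ : z ∈ replace p x y → (z ∈ p × z ≢ x) ⊎ z ≡ y
∈-replace⁻ {p = p} {x} {y} z∈ with x∈p∪q⁻ (p - x) ⁅ y ⁆ z∈
... | inj₁ z∈p-x = inj₁ (p─q⊆p p _ z∈p-x , x∈p-y⇒x≢y z∈p-x)
... | inj₂ z∈⁅y⁆ = inj₂ (x∈⁅y⁆⇒x≡y y z∈⁅y⁆)

Avoids : Subset n → Subset n → Set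
Avoids C S = ∀ {x} → x ∈ C → x ∉ S

IsClique : Graph n → Subset n → Set
IsClique G C = ∀ {x y} → x ∈ C → y ∈ C → x ≢ y → Adj G x y

avoids? : (S C : Subset n) → Dec (Avoids C S)
avoids? S C = map′ (λ f {x} → f x) (λ f x → f) (Fin.all? λ x → x ∈? C →-dec ¬? (x ∈? S))

isClique? : (G : Graph n) (C : Subset n) → Dec (IsClique G C)
isClique? G C = map′ (λ f {x} {y} → f x y) (λ f x y → f) (Fin.all? λ x → Fin.all? λ y →
  x ∈? C →-dec y ∈? C →-dec ¬? (x Fin.≟ y) →-dec adj G x y Bool.≟ true)

isCliqueAvoiding? : (G : Graph n) (S : Subset n) → Decidable (IsCliqueAvoiding G S)
isCliqueAvoiding? G S C = avoids? S C ×-dec isClique? G C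

⊥-isCliqueAvoiding : (G : Graph n) (S : Subset n) → IsCliqueAvoiding G S ⊥
⊥-isCliqueAvoiding G S = (λ x∈⊥ → contradiction x∈⊥ ∉⊥) , (λ x∈⊥ → contradiction x∈⊥ ∉⊥)

avoids-replace : ∀ {C S u v} → v ∉ C → Avoids C (replace {n} S v u) → Avoids C S
avoids-replace v∉C C∩S'=∅ x∈C x∈S =
  C∩S'=∅ x∈C (∈-replaceˡ x∈S λ { refl → v∉C x∈C })

replace-avoids : ∀ {C S u v} → u ∉ S → Avoids C (replace {n} S v u) → Avoids (replace C v u) S
replace-avoids u∉S C∩S'=∅ x∈C' x∈S with ∈-replace⁻ x∈C'
... | inj₁ (x∈C , x≢v) = C∩S'=∅ x∈C (∈-replaceˡ x∈S x≢v)
... | inj₂ refl         = u∉S x∈S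

module _ (G : Graph n) {C : Subset n} {u v : Fin n}
         (u≽v : Dominates G u v) (clique : IsClique G C) (v∈C : v ∈ C) (u∉C : u ∉ C) where

  private
    adj-u : x ∈ C → x ≢ v → Adj G u x
    adj-u x∈C x≢v = u≽v (clique v∈C x∈C (x≢v ∘ sym)) λ { refl → u∉C x∈C }

  replace-isClique : IsClique G (replace C v u)
  replace-isClique x∈ y∈ x≢y with ∈-replace⁻ x∈ | ∈-replace⁻ y∈
  ... | inj₁ (x∈C , _)   | inj₁ (y∈C , _)   = clique x∈C y∈C x≢y
  ... | inj₁ (x∈C , x≢v) | inj₂ refl        = Adj-sym G (adj-u x∈C x≢v)
  ... | inj₂ refl        | inj₁ (y∈C , y≢v) = adj-u y∈C y≢v
  ... | inj₂ refl        | inj₂ refl        = contradiction refl x≢y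

replace-cliques≤ : ∀ (G : Graph n) {S u v t} → Dominates G u v → u ∉ S →
                   (∀ C → IsCliqueAvoiding G S C → ∣ C ∣ ≤ t) →
                   ∀ C → IsCliqueAvoiding G (replace S v u) C → ∣ C ∣ ≤ t
replace-cliques≤ G {S} {u} {v} {t} u≽v u∉S bound C (C∩S'=∅ , clique) with v ∈? C
... | no v∉C  = bound C (avoids-replace v∉C C∩S'=∅ , clique)
... | yes v∈C = subst (_≤ t) (∣replace∣ v∈C u∉C)
                  (bound (replace C v u)
                         (replace-avoids u∉S C∩S'=∅ , replace-isClique G u≽v clique v∈C u∉C))
  where
  u∉C : u ∉ C
  u∉C u∈C = C∩S'=∅ u∈C ∈-replaceʳ

MaxCard : (Subset n → Set) → ℕ → Set
MaxCard P m = (Σ (Subset _) λ C → P C × ∣ C ∣ ≡ m) × (∀ C → P C → ∣ C ∣ ≤ m)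

maxCard-exists : (P : Subset n → Set) → Decidable P → P ⊥ → ∃ (MaxCard P)
maxCard-exists {n} P P? P⊥ = search n (λ C _ → ∣p∣≤n C)
  where
  search : ∀ m → (∀ C → P C → ∣ C ∣ ≤ m) → ∃ (MaxCard P)
  search m bound with anySubset? (λ C → P? C ×-dec (∣ C ∣ ≟ m))
  ... | yes attained = m , attained , bound
  search zero    bound | no unattained = contradiction (⊥ , P⊥ , ∣⊥∣≡0 n) unattained
  search (suc m) bound | no unattained =
    search m λ C PC → m<1+n⇒m≤n (≤∧≢⇒< (bound C PC) λ ∣C∣≡1+m → unattained (C , PC , ∣C∣≡1+m))

maxCard≤ : ∀ {P : Subset n → Set} {m t} → MaxCard P m → (∀ C → P C → ∣ C ∣ ≤ t) → m ≤ t
maxCard≤ {t = t} ((C , PC , ∣C∣≡m) , _) bound = subst (_≤ t) ∣C∣≡m (bound C PC)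

cliqueNumber-exists : (G : Graph n) (S : Subset n) → ∃ (CliqueNumberAvoiding G S)
cliqueNumber-exists G S =
  maxCard-exists (IsCliqueAvoiding G S) (isCliqueAvoiding? G S) (⊥-isCliqueAvoiding G S)

lemma9 : ∀ {n} (G : Graph n) (k : ℕ) (u v : Fin n) →
         (N G v ⊂ N G u ⊎ N[ G , v ] ⊂ N[ G , u ]) →
         (S : Subset n) → OptInterdiction G k S → v ∈ S → u ∉ S →
         OptInterdiction G k ((S - v) ∪ ⁅ u ⁆)
lemma9 G k u v v≺u S (∣S∣≤k , t , θ , ωS) v∈S u∉S with cliqueNumber-exists G (replace S v u)
... | m , ωS' = ∣S'∣≤k , t , θ , subst (CliqueNumberAvoiding G S') m≡t ωS'
  where
  S' : Subset _
  S' = replace S v u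
  u≽v : Dominates G u v
  u≽v = [ N⊆N⇒dominates G ∘ proj₁ , N[]⊆N[]⇒dominates G ∘ proj₁ ]′ v≺u
  ∣S'∣≤k : ∣ S' ∣ ≤ k
  ∣S'∣≤k = subst (_≤ k) (sym (∣replace∣ v∈S u∉S)) ∣S∣≤k
  m≡t : m ≡ t
  m≡t = ≤-antisym (maxCard≤ ωS' (replace-cliques≤ G u≽v u∉S (proj₂ ωS))) (proj₂ θ S' m ∣S'∣≤k ωS')
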